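{- Let $G=(V,E)$ be an unweighted undirected graph with shortest-path metric $d=d_G$, let $k,\alpha$ be non-negative integers with $\alpha<k$, and let $L:V\to\mathbb{Z}_{\ge 0}$. Suppose $(G,k,L,\alpha)$ is feasible for the capacitated conservative $\alpha$-fault-tolerant $k$-center, and let $(S^*,\phi^*_0)$ be a corresponding distance-$1$ solution. If $W\subseteq S^*$ is an $(\alpha,4)$-independent set in $G$, then $(G,k-|W|,L')$ is feasible for the capacitated $k$-center, where $L'_u=0$ for $u\in W$ and $L'_u=L_u$ otherwise.
   Context: For $u\in V$, $N(u)=\{v: d(u,v)\le 1\}$, and for $U\subseteq V$, $N^\ell(U)=\{v: d(v,U)\le \ell\}$; $d(A,B)=\min_{a\in A,b\in B}d(a,b)$. An instance $(G,k',L')$ of the capacitated $k$-center is feasible if there exist a set $S\subseteq V$ of $k'$ centers and an assignment $\phi:V\to S$ with $d(u,\phi(u))\le 1$ for all $u$ and $|\phi^{ -1}(v)|\le L'_v$ for all $v\in S$. A distance-$1$ solution of the capacitated conservative $\alpha$-fault-tolerant $k$-center instance $(G,k,L,\alpha)$ is a pair $(S,\phi_0)$ with $S\subseteq V$, $|S|=k$, $\phi_0:V\to S$ with $|\phi_0^{ -1}(v)|\le L_v$ and $d(u,\phi_0(u))\le 1$, such that for every $F\subseteq S$ with $|F|\le\alpha$ there is an assignment $\phi_F:V\to S\setminus F$ with $|\phi_F^{ -1}(v)|\le L_v$ for all $v$, $d(u,\phi_F(u))\le 1$ for all $u$, and which is conservative: $\phi_F(u)=\phi_0(u)$ whenever $\phi_0(u)\notin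 F$. The instance is feasible if such a solution exists. A set $W\subseteq V$ is $(\alpha,\ell)$-independent if it can be partitioned into sets $C_1,\dots,C_t$ with $|C_i|\le\alpha$ for all $i$ and $d(C_i,C_j)>\ell$ for all $i<j$. -}

module Defs where

open import Data.Nat using (ℕ; zero; suc; _≤_; _<_; _∸_)
open import Data.Bool using (Bool; true; false; T; if_then_else_)
open import Data.Fin using (Fin; _≟_)
open import Data.Fin.Subset using (Subset; _∈_; _∉_; _⊆_; ∣_∣; ⊥)
open import Data.Vec using (tabulate)
open import Data.Product using (Σ; _×_; ∃; ∃-syntax)
open import Relation.Nullary using (¬_; does)
open import Relation.Binary.PropositionalEquality using (_≡_)

record Graph (n : ℕ) : Set where
  field
    adj   : Fin n → Fin n → Bool
    sym   : ∀ u v → adj u v ≡ adj v u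
    irrefl : ∀ u → adj u u ≡ false
open Graph public

data Walk {n : ℕ} (G : Graph n) : ℕ → Fin n → Fin n → Set where
  here : ∀ {u} → Walk G zero u u
  step : ∀ {m u w v} → T (adj G u w) → Walk G m w v → Walk G (suc m) u v

Dist≤ : {n : ℕ} → Graph n → ℕ → Fin n → Fin n → Set
Dist≤ G ℓ u v = ∃[ m ] (m ≤ ℓ × Walk G m u v)

preimageSize : {n : ℕ} → (Fin n → Fin n) → Fin n → ℕ
preimageSize φ v = ∣ tabulate (λ u → does (φ u ≟ v)) ∣

ValidAssignment : {n : ℕ} → Graph n → (Fin n → ℕ) → Subset n → (Fin n → Fin n) → Set
ValidAssignment G L S φ =
  (∀ u → φ u ∈ S) × (∀ v → v ∈ S → preimageSize φ v ≤ L v) × (∀ u → Dist≤ G 1 u (φ u))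

CapFeasible : {n : ℕ} → Graph n → ℕ → (Fin n → ℕ) → Set
CapFeasible G k' L' = Σ (Subset _) λ S → ∣ S ∣ ≡ k' × Σ (Fin _ → Fin _) λ φ → ValidAssignment G L' S φ

FTSolution : {n : ℕ} → Graph n → ℕ → (Fin n → ℕ) → ℕ → Subset n → (Fin n → Fin n) → Set
FTSolution {n} G k L α S φ₀ =
  ∣ S ∣ ≡ k × ValidAssignment G L S φ₀ ×
  (∀ (F : Subset n) → F ⊆ S → ∣ F ∣ ≤ α →
     Σ (Fin n → Fin n) λ φF →
       (∀ u → φF u ∉ F) × ValidAssignment G L S φF ×
       (∀ u → φ₀ u ∉ F → φF u ≡ φ₀ u))

Independent : {n : ℕ} → Graph n → ℕ → ℕ → Subset n → Set
Independent {n} G α ℓ W =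
  Σ ℕ λ t → Σ (Fin n → Fin t) λ c →
    (∀ (i : Fin t) → ∣ tabulate (λ u → Data.Bool._∧_ (does (c u ≟ i)) (Data.Vec.lookup W u)) ∣ ≤ α) ×
    (∀ u v → u ∈ W → v ∈ W → ¬ (c u ≡ c v) → ¬ Dist≤ G ℓ u v)

zeroOn : {n : ℕ} → Subset n → (Fin n → ℕ) → Fin n → ℕ
zeroOn W L u = if Data.Vec.lookup W u then 0 else L u

-- Let c split W into classes C_i.  A client u whose centre φ₀ u lies in W is moved to
-- its centre under the conservative failover assignment ψ_i for the failure of the class
-- C_i ∋ φ₀ u; every other client keeps its centre.  The new centre is within distance 2
-- of φ₀ u, so it lies outside W: other classes are more than 4 away and ψ_i avoids C_i.
-- Two clients moved to a common centre v had old centres within distance 4 of each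
-- other, hence in one class C_i; as ψ_i keeps every client whose centre is outside W,
-- everyone now served by v is also served by v under ψ_i, which respects L_v.
module Submission where

open import Defs hiding (sym)
open import Data.Nat using (ℕ; _<_; _∸_; _≤_; _+_; suc; s≤s; z≤n)
open import Data.Nat.Properties using (≤-trans; +-mono-≤; +-comm; +-suc; m+n∸n≡m)
open import Data.Bool using (Bool; true; false; T; _∧_)
open import Data.Bool.Properties using (T-≡; T-∧)
open import Data.Fin using (Fin; _≟_)
open import Data.Fin.Properties using (any?)
open import Data.Fin.Subset using (Subset; _⊆_; ∣_∣; _∈_; _∉_; _─_; inside; outside)
open import Data.Fin.Subset.Properties
  using (_∈?_; p⊆q⇒∣p∣≤∣q∣; drop-∷-⊆; x∈p∧x∉q⇒x∈p─q; p─q⊆p)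
open import Data.Vec using ([]; _∷_; lookup; tabulate; here; there)
open import Data.Vec.Properties using ([]=⇒lookup; lookup⇒[]=; lookup∘tabulate)
open import Data.Product using (Σ; _×_; _,_; proj₁; proj₂)
open import Data.Unit using (tt)
open import Function using (_∘′_; const)
open import Function.Bundles using (_⇔_; mk⇔; Equivalence)
open import Relation.Nullary using (¬_; Dec; yes; no; does; contradiction)
open import Relation.Nullary.Decidable using (_×-dec_; decidable-stable)
open import Relation.Binary.PropositionalEquality
  using (_≡_; refl; sym; trans; cong; subst)

open Equivalence using (to; from)

T-does : ∀ {a} {A : Set a} (a? : Dec A) → T (does a?) ⇔ A
T-does (yes a) = mk⇔ (const a) (const tt)
T-does (no ¬a) = mk⇔ (λ ()) ¬a

private
  variable
    n : ℕ

∈⇔T-lookup : {x : Fin n} {p : Subset n} → x ∈ p ⇔ T (lookup p x)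
∈⇔T-lookup {x = x} {p} = mk⇔ (from T-≡ ∘′ []=⇒lookup) (lookup⇒[]= x p ∘′ to T-≡)

∈-tabulate : {f : Fin n → Bool} {x : Fin n} → x ∈ tabulate f ⇔ T (f x)
∈-tabulate {f = f} {x} = mk⇔
  (λ x∈ → subst T (lookup∘tabulate f x) (to ∈⇔T-lookup x∈))
  (λ fx → from ∈⇔T-lookup (subst T (sym (lookup∘tabulate f x)) fx))

∣p─q∣+∣q∣≡∣p∣ : {p q : Subset n} → q ⊆ p → ∣ p ─ q ∣ + ∣ q ∣ ≡ ∣ p ∣
∣p─q∣+∣q∣≡∣p∣ {p = []}          {[]}          _   = refl
∣p─q∣+∣q∣≡∣p∣ {p = outside ∷ p} {outside ∷ q} q⊆p = ∣p─q∣+∣q∣≡∣p∣ (drop-∷-⊆ q⊆p)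
∣p─q∣+∣q∣≡∣p∣ {p = inside  ∷ p} {outside ∷ q} q⊆p = cong suc (∣p─q∣+∣q∣≡∣p∣ (drop-∷-⊆ q⊆p))
∣p─q∣+∣q∣≡∣p∣ {p = inside  ∷ p} {inside  ∷ q} q⊆p =
  trans (+-suc ∣ p ─ q ∣ ∣ q ∣) (cong suc (∣p─q∣+∣q∣≡∣p∣ (drop-∷-⊆ q⊆p)))
∣p─q∣+∣q∣≡∣p∣ {p = outside ∷ p} {inside  ∷ q} q⊆p = contradiction (q⊆p here) λ ()

∣p─q∣≡∣p∣∸∣q∣ : {p q : Subset n} → q ⊆ p → ∣ p ─ q ∣ ≡ ∣ p ∣ ∸ ∣ q ∣
∣p─q∣≡∣p∣∸∣q∣ {p = p} {q} q⊆p =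
  trans (sym (m+n∸n≡m ∣ p ─ q ∣ ∣ q ∣)) (cong (_∸ ∣ q ∣) (∣p─q∣+∣q∣≡∣p∣ q⊆p))

x∈p─q⇒x∉q : {x : Fin n} (p q : Subset n) → x ∈ p ─ q → x ∉ q
x∈p─q⇒x∉q (_ ∷ p)       (_ ∷ q)      (there x∈) (there x∈q) = x∈p─q⇒x∉q p q x∈ x∈q
x∈p─q⇒x∉q (inside ∷ p)  (inside ∷ q) ()         here
x∈p─q⇒x∉q (outside ∷ p) (inside ∷ q) ()         here

preimage : (Fin n → Fin n) → Fin n → Subset n
preimage φ v = tabulate (λ u → does (φ u ≟ v))

∈-preimage : {φ : Fin n → Fin n} {u v : Fin n} → u ∈ preimage φ v ⇔ φ u ≡ v
∈-preimage {φ = φ} {u} {v} = mk⇔ (to (T-does (φ u ≟ v)) ∘′ to ∈-tabulate)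
                              (from ∈-tabulate ∘′ from (T-does (φ u ≟ v)))

preimageSize-mono : (φ ψ : Fin n → Fin n) {v v′ : Fin n} →
                    (∀ u → φ u ≡ v → ψ u ≡ v′) → preimageSize φ v ≤ preimageSize ψ v′
preimageSize-mono φ ψ {v} {v′} φ⇒ψ =
  p⊆q⇒∣p∣≤∣q∣ {p = preimage φ v} {preimage ψ v′}
    (λ {u} u∈ → from (∈-preimage {φ = ψ}) (φ⇒ψ u (to (∈-preimage {φ = φ}) u∈)))

zeroOn-∉ : {W : Subset n} (L : Fin n → ℕ) {v : Fin n} → v ∉ W → zeroOn W L v ≡ L v
zeroOn-∉ {W = W} L {v} v∉W with lookup W v in eq
... | true  = contradiction (from ∈⇔T-lookup (from T-≡ eq)) v∉W
... | false = refl

classOf : {t : ℕ} → (Fin n → Fin t) → Subset n → Fin t → Subset n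
classOf c W i = tabulate (λ u → does (c u ≟ i) ∧ lookup W u)

∈-classOf : {t : ℕ} (c : Fin n → Fin t) {W : Subset n} {i : Fin t} {u : Fin n} →
            u ∈ classOf c W i ⇔ (c u ≡ i × u ∈ W)
∈-classOf c {W} {i} {u} = mk⇔
  (λ u∈ → let (c≡ , u∈W) = to T-∧ (to ∈-tabulate u∈)
          in to (T-does (c u ≟ i)) c≡ , from ∈⇔T-lookup u∈W)
  (λ (c≡ , u∈W) → from ∈-tabulate (from T-∧ (from (T-does (c u ≟ i)) c≡ , to ∈⇔T-lookup u∈W)))

module _ {n : ℕ} (G : Graph n) where

  adj-sym : {u v : Fin n} → T (adj G u v) → T (adj G v u)
  adj-sym {u} {v} = subst T (Graph.sym G u v)

  _++ʷ_ : {m m′ : ℕ} {u v w : Fin n} → Walk G m u v → Walk G m′ v w → Walk G (m + m′) u w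
  here     ++ʷ q = q
  step e p ++ʷ q = step e (p ++ʷ q)

  reverseʷ : {m : ℕ} {u v : Fin n} → Walk G m u v → Walk G m v u
  reverseʷ here = here
  reverseʷ {suc m} {u} {v} (step e p) =
    subst (λ k → Walk G k v u) (+-comm m 1) (reverseʷ p ++ʷ step (adj-sym e) here)

  Dist≤-sym : {ℓ : ℕ} {u v : Fin n} → Dist≤ G ℓ u v → Dist≤ G ℓ v u
  Dist≤-sym (m , m≤ℓ , p) = m , m≤ℓ , reverseʷ p

  Dist≤-trans : {ℓ ℓ′ : ℕ} {u v w : Fin n} → Dist≤ G ℓ u v → Dist≤ G ℓ′ v w → Dist≤ G (ℓ + ℓ′) u w
  Dist≤-trans (m , m≤ℓ , p) (m′ , m′≤ℓ′ , q) = m + m′ , +-mono-≤ m≤ℓ m′≤ℓ′ , p ++ʷ q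

  Dist≤-weaken : {ℓ ℓ′ : ℕ} {u v : Fin n} → ℓ ≤ ℓ′ → Dist≤ G ℓ u v → Dist≤ G ℓ′ u v
  Dist≤-weaken ℓ≤ℓ′ (m , m≤ℓ , p) = m , ≤-trans m≤ℓ ℓ≤ℓ′ , p

Failover : Graph n → (Fin n → ℕ) → Subset n → (Fin n → Fin n) → Subset n → Set
Failover {n} G L S φ₀ F =
  Σ (Fin n → Fin n) λ φF →
    (∀ u → φF u ∉ F) × ValidAssignment G L S φF × (∀ u → φ₀ u ∉ F → φF u ≡ φ₀ u)

module Reassignment
  {n t : ℕ} (G : Graph n) (L : Fin n → ℕ) (S W : Subset n) (φ₀ : Fin n → Fin n)
  (φ₀∈S : ∀ u → φ₀ u ∈ S)
  (φ₀-capacity : ∀ v → v ∈ S → preimageSize φ₀ v ≤ L v)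
  (φ₀-near : ∀ u → Dist≤ G 1 u (φ₀ u))
  (c : Fin n → Fin t)
  (c-local : ∀ {x y} → x ∈ W → y ∈ W → Dist≤ G 4 x y → c x ≡ c y)
  (failover : ∀ i → Failover G L S φ₀ (classOf c W i))
  where

  ψ : Fin t → Fin n → Fin n
  ψ i = proj₁ (failover i)

  ψ-avoids : ∀ i u → ψ i u ∉ classOf c W i
  ψ-avoids i = proj₁ (proj₂ (failover i))

  ψ∈S : ∀ i u → ψ i u ∈ S
  ψ∈S i = proj₁ (proj₁ (proj₂ (proj₂ (failover i))))

  ψ-capacity : ∀ i v → v ∈ S → preimageSize (ψ i) v ≤ L v
  ψ-capacity i = proj₁ (proj₂ (proj₁ (proj₂ (proj₂ (failover i)))))

  ψ-near : ∀ i u → Dist≤ G 1 u (ψ i u)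
  ψ-near i = proj₂ (proj₂ (proj₁ (proj₂ (proj₂ (failover i)))))

  ψ-conservative : ∀ i u → φ₀ u ∉ classOf c W i → ψ i u ≡ φ₀ u
  ψ-conservative i = proj₂ (proj₂ (proj₂ (failover i)))

  moved-∉W : ∀ u → φ₀ u ∈ W → ψ (c (φ₀ u)) u ∉ W
  moved-∉W u φ₀u∈W ψu∈W =
    ψ-avoids (c (φ₀ u)) u (from (∈-classOf c) (c-local ψu∈W φ₀u∈W ψu-near-φ₀u , ψu∈W))
    where
    ψu-near-φ₀u : Dist≤ G 4 (ψ (c (φ₀ u)) u) (φ₀ u)
    ψu-near-φ₀u = Dist≤-weaken G (s≤s (s≤s z≤n))
      (Dist≤-trans G (Dist≤-sym G (ψ-near _ u)) (φ₀-near u))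

  reassign : (u : Fin n) → Dec (φ₀ u ∈ W) → Fin n
  reassign u (yes _) = ψ (c (φ₀ u)) u
  reassign u (no _)  = φ₀ u

  φ : Fin n → Fin n
  φ u = reassign u (φ₀ u ∈? W)

  φ∈S─W : ∀ u → φ u ∈ S ─ W
  φ∈S─W u with φ₀ u ∈? W
  ... | yes φ₀u∈W = x∈p∧x∉q⇒x∈p─q (ψ∈S _ u) (moved-∉W u φ₀u∈W)
  ... | no  φ₀u∉W = x∈p∧x∉q⇒x∈p─q (φ₀∈S u) φ₀u∉W

  φ-near : ∀ u → Dist≤ G 1 u (φ u)
  φ-near u with φ₀ u ∈? W
  ... | yes _ = ψ-near _ u
  ... | no  _ = φ₀-near u

  MovedTo : Fin n → Fin n → Set
  MovedTo v u = φ₀ u ∈ W × ψ (c (φ₀ u)) u ≡ v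

  movedTo? : ∀ v u → Dec (MovedTo v u)
  movedTo? v u = (φ₀ u ∈? W) ×-dec (ψ (c (φ₀ u)) u ≟ v)

  movedTo-sameClass : ∀ {v u u′} → MovedTo v u → MovedTo v u′ → c (φ₀ u) ≡ c (φ₀ u′)
  movedTo-sameClass {v} {u} {u′} (φ₀u∈W , refl) (φ₀u′∈W , ψu′≡v) =
    c-local φ₀u∈W φ₀u′∈W
      (Dist≤-trans G (Dist≤-trans G (Dist≤-sym G (φ₀-near u)) (ψ-near _ u))
                     (Dist≤-trans G (Dist≤-sym G (subst (Dist≤ G 1 u′) ψu′≡v (ψ-near _ u′)))
                                    (φ₀-near u′)))

  preimage-movedTo : ∀ {v u′} → MovedTo v u′ → ∀ u → φ u ≡ v → ψ (c (φ₀ u′)) u ≡ v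
  preimage-movedTo {v} u′-moved u with φ₀ u ∈? W
  ... | yes φ₀u∈W = λ φu≡v →
        subst (λ i → ψ i u ≡ v) (movedTo-sameClass (φ₀u∈W , φu≡v) u′-moved) φu≡v
  ... | no  φ₀u∉W = λ φu≡v →
        trans (ψ-conservative _ u (φ₀u∉W ∘′ proj₂ ∘′ to (∈-classOf c))) φu≡v

  preimage-unmoved : ∀ {v} → ¬ (Σ (Fin n) (MovedTo v)) → ∀ u → φ u ≡ v → φ₀ u ≡ v
  preimage-unmoved none u with φ₀ u ∈? W
  ... | yes φ₀u∈W = λ φu≡v → contradiction (u , φ₀u∈W , φu≡v) none
  ... | no  _     = λ φu≡v → φu≡v

  φ-capacity : ∀ v → v ∈ S → preimageSize φ v ≤ L v
  φ-capacity v v∈S with any? (movedTo? v)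
  ... | yes (u′ , u′-moved) =
        ≤-trans (preimageSize-mono φ (ψ _) (preimage-movedTo u′-moved)) (ψ-capacity _ v v∈S)
  ... | no none = ≤-trans (preimageSize-mono φ φ₀ (preimage-unmoved none)) (φ₀-capacity v v∈S)

  φ-valid : ValidAssignment G (zeroOn W L) (S ─ W) φ
  φ-valid = φ∈S─W , capacity , φ-near
    where
    capacity : ∀ v → v ∈ S ─ W → preimageSize φ v ≤ zeroOn W L v
    capacity v v∈S─W = subst (preimageSize φ v ≤_) (sym (zeroOn-∉ L (x∈p─q⇒x∉q S W v∈S─W)))
                             (φ-capacity v (p─q⊆p S W v∈S─W))

lemma1 : (n : ℕ) (G : Graph n) (k α : ℕ) (L : Fin n → ℕ) → α < k →
    (S : Subset n) (φ₀ : Fin n → Fin n) → FTSolution G k L α S φ₀ →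
    (W : Subset n) → W ⊆ S → Independent G α 4 W →
    CapFeasible G (k ∸ ∣ W ∣) (zeroOn W L)
lemma1 n G k α L _ S φ₀ (∣S∣≡k , (φ₀∈S , φ₀-capacity , φ₀-near) , failover)
       W W⊆S (t , c , class-small , separated) =
  S ─ W , trans (∣p─q∣≡∣p∣∸∣q∣ W⊆S) (cong (_∸ ∣ W ∣) ∣S∣≡k) , φ , φ-valid
  where
  c-local : ∀ {x y} → x ∈ W → y ∈ W → Dist≤ G 4 x y → c x ≡ c y
  c-local {x} {y} x∈W y∈W near =
    decidable-stable (c x ≟ c y) (λ differ → separated x y x∈W y∈W differ near)

  open Reassignment G L S W φ₀ φ₀∈S φ₀-capacity φ₀-near c c-local
    (λ i → failover (classOf c W i) (W⊆S ∘′ proj₂ ∘′ to (∈-classOf c)) (class-small i))
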